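{- Let $\pi,\chi,\rho$ be partitions of $[n]$ such that $\pi\sim\chi$ and $\rho\sim\chi$. Then $\pi\sqcup\chi\sim\rho$ if and only if $\pi\sim\rho\sqcup\chi$.
   Context: A forest $G$ on vertex set $[n]\cup V$ (with boundary $[n]$) is a representative forest of a partition $\pi$ of $[n]$ if for every block $S\in\pi$ there is a component $C$ of $G$ with $C\cap[n]=S$. The glue $G\oplus H$ of two graphs with boundary $[n]$ is their disjoint union with the two copies of each boundary vertex identified. Partitions $\pi,\rho$ of $[n]$ induce a cycle if $G_\pi\oplus G_\rho$ contains a cycle for representative forests $G_\pi,G_\rho$ (independent of the choice); $\pi\sim\rho$ ($\pi,\rho$ compatible) means they do not induce a cycle. The join $\pi\sqcup\rho$ is the finest partition of $[n]$ that is coarser than both $\pi$ and $\rho$ (every block of $\pi$ and of $\rho$ is contained in a block of $\pi\sqcup\rho$). -}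

module Defs where

open import Data.Nat using (ℕ; _+_)
open import Data.Fin using (Fin; _↑ˡ_; _↑ʳ_)
open import Data.Sum using (_⊎_; inj₁; inj₂)
open import Data.Product using (_×_; _,_; Σ; ∃; proj₁; proj₂)
open import Data.List using (List; map; _++_; length; lookup; removeAt)
open import Data.List.Membership.Propositional using (_∈_)
open import Relation.Binary.PropositionalEquality using (_≡_)
open import Relation.Binary.Construct.Closure.ReflexiveTransitive using (Star)
open import Relation.Nullary using (¬_)
open import Function.Bundles using (_⇔_)

-- Partitions of [n] = Fin n, given by a block labelling:
-- i and j lie in the same block iff their labels agree.
-- (Every partition of [n] arises this way.)

Partition : ℕ → Set
Partition n = Fin n → ℕ

Coarser : ∀ {n} → Partition n → Partition n → Set
Coarser {n} σ π = ∀ (i j : Fin n) → π i ≡ π j → σ i ≡ σ j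

IsJoin : ∀ {n} → Partition n → Partition n → Partition n → Set
IsJoin π ρ σ =
  Coarser σ π × Coarser σ ρ × (∀ τ → Coarser τ π → Coarser τ ρ → Coarser τ σ)

-- Finite multigraphs with boundary [n]: vertex set [n] ⊎ V with V = Fin inner,
-- edges given as a list (parallel edges and loops allowed).

Vtx : ℕ → ℕ → Set
Vtx n m = Fin n ⊎ Fin m

record Graph (n : ℕ) : Set where
  field
    inner : ℕ
    edges : List (Vtx n inner × Vtx n inner)
open Graph public

Adj : ∀ {V : Set} → List (V × V) → V → V → Set
Adj E u v = ((u , v) ∈ E) ⊎ ((v , u) ∈ E)

Connected : ∀ {V : Set} → List (V × V) → V → V → Set
Connected E = Star (Adj E)

-- A multigraph contains a cycle iff some edge uv has its endpoints joined
-- by a walk in the graph with that edge removed (covers loops and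
-- parallel edges).
HasCycle : ∀ {V : Set} → List (V × V) → Set
HasCycle E = Σ (Fin (length E)) λ e →
  Connected (removeAt E e) (proj₁ (lookup E e)) (proj₂ (lookup E e))

IsForest : ∀ {n} → Graph n → Set
IsForest G = ¬ HasCycle (edges G)

-- G is a representative forest of π: G is a forest, and for every block
-- S of π (S = block of j) there is a component C (the component of a
-- vertex c) with C ∩ [n] = S.
IsRepForest : ∀ {n} → Partition n → Graph n → Set
IsRepForest {n} π G =
  IsForest G ×
  (∀ (j : Fin n) → Σ (Vtx n (inner G)) λ c →
     ∀ (i : Fin n) → Connected (edges G) (inj₁ i) c ⇔ (π i ≡ π j))

-- Glue: disjoint union with the boundary copies identified.

embL : ∀ {n a} b → Vtx n a → Vtx n (a + b)
embL b (inj₁ i) = inj₁ i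
embL b (inj₂ k) = inj₂ (k ↑ˡ b)

embR : ∀ {n} a {b} → Vtx n b → Vtx n (a + b)
embR a (inj₁ i) = inj₁ i
embR a (inj₂ k) = inj₂ (a ↑ʳ k)

mapEdge : ∀ {A B : Set} → (A → B) → A × A → B × B
mapEdge f (u , v) = f u , f v

glue : ∀ {n} → Graph n → Graph n → Graph n
glue G H = record
  { inner = inner G + inner H
  ; edges = map (mapEdge (embL (inner H))) (edges G)
            ++ map (mapEdge (embR (inner G))) (edges H) }

-- π and ρ induce a cycle if the glue of representative forests contains a
-- cycle (this is independent of the choice of forests).

InduceCycle : ∀ {n} → Partition n → Partition n → Set
InduceCycle {n} π ρ = Σ (Graph n) λ Gπ → Σ (Graph n) λ Gρ →
  IsRepForest π Gπ × IsRepForest ρ Gρ × HasCycle (edges (glue Gπ Gρ))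

_∼_ : ∀ {n} → Partition n → Partition n → Set
π ∼ ρ = ¬ InduceCycle π ρ

{-# OPTIONS --safe #-}
-- The boundary connectivity of a glue G ⊕ H is the join of the partitions realised by G and H,
-- so if π ∼ χ then G_π ⊕ G_χ is a representative forest of π ⊔ χ, and π ⊔ χ ∼ ρ makes
-- (G_π ⊕ G_χ) ⊕ G_ρ = G_π ⊕ (G_χ ⊕ G_ρ) acyclic.  Replacing the factor G_χ ⊕ G_ρ by any forest
-- whose boundary connectivity is no coarser (such as G_{ρ⊔χ}) cannot create a cycle, hence
-- π ∼ ρ ⊔ χ.  The converse is the same argument with π and ρ exchanged, as ∼ is symmetric.
module Submission where

open import Defs
open import Data.Nat using (ℕ; suc; _+_; s≤s)
open import Data.Fin using (Fin; zero; suc; _↑ˡ_; _↑ʳ_; splitAt; fromℕ<; toℕ)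
import Data.Fin as Fin
open import Data.Fin.Properties
  using (↑ˡ-injective; ↑ʳ-injective; splitAt-↑ˡ; splitAt-↑ʳ; toℕ-fromℕ<; fromℕ<-cong)
open import Data.Sum using (_⊎_; inj₁; inj₂; [_,_]′)
import Data.Sum as Sum
open import Data.Sum.Properties using (≡-dec; inj₂-injective)
open import Data.Product using (_×_; _,_; ∃; proj₁; proj₂)
open import Data.List using (List; []; _∷_; map; _++_; lookup; removeAt; allFin)
open import Data.List.Properties using (map-++; map-∘; map-cong; ++-assoc)
open import Data.List.Membership.Propositional using (_∈_)
open import Data.List.Membership.Propositional.Properties
  using (∈-map⁺; ∈-map⁻; ∈-++⁺ˡ; ∈-++⁺ʳ; ∈-++⁻; ∈-lookup; ∈-allFin)
open import Data.List.Relation.Unary.Any using (here; there)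
open import Data.List.Relation.Unary.All using (All) renaming (lookup to All-lookup)
open import Data.List.Relation.Unary.Unique.Propositional using (Unique)
open import Data.List.Relation.Unary.AllPairs using ([]; _∷_)
open import Data.List.Relation.Unary.Unique.Propositional.Properties using (allFin⁺)
open import Data.List.Extrema.Nat using (max; xs≤max)
open import Data.List.Relation.Binary.Permutation.Propositional using (_↭_; ↭-sym)
import Data.List.Relation.Binary.Permutation.Propositional as ↭
open import Data.List.Relation.Binary.Permutation.Propositional.Properties using (∈-resp-↭; ++-comm)
open import Relation.Binary.PropositionalEquality
  using (_≡_; _≢_; refl; sym; trans; cong; cong₂; subst; _≗_; module ≡-Reasoning)
open import Relation.Binary.Construct.Closure.ReflexiveTransitive
  using (ε; _◅_; _◅◅_; gmap; reverse; return)
open import Relation.Binary.Definitions using (DecidableEquality)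
open import Relation.Binary.Structures using (IsDecEquivalence)
open import Relation.Nullary using (¬_; Dec; yes; no; contradiction)
open import Relation.Nullary.Decidable using (map′; _⊎-dec_; _×-dec_)
open import Function using (_∘_; id)
open import Function.Definitions using (Injective)
open import Function.Bundles using (_⇔_; mk⇔; Equivalence)
open Equivalence using (to; from)

module _ {V : Set} where

  Adj-sym : ∀ {E : List (V × V)} {u v} → Adj E u v → Adj E v u
  Adj-sym (inj₁ p) = inj₂ p
  Adj-sym (inj₂ p) = inj₁ p

  Adj-++⁻ : ∀ {E F : List (V × V)} {u v} → Adj (E ++ F) u v → Adj E u v ⊎ Adj F u v
  Adj-++⁻ {E} (inj₁ p) = Sum.map inj₁ inj₁ (∈-++⁻ E p)
  Adj-++⁻ {E} (inj₂ p) = Sum.map inj₂ inj₂ (∈-++⁻ E p)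

  Connected-sym : ∀ {E : List (V × V)} {u v} → Connected E u v → Connected E v u
  Connected-sym = reverse Adj-sym

  edge⇒Connected : ∀ {E : List (V × V)} {u v} → (u , v) ∈ E → Connected E u v
  edge⇒Connected uv∈E = return (inj₁ uv∈E)

  Connected-mono : ∀ {E F : List (V × V)} → (∀ {e} → e ∈ E → e ∈ F) →
                   ∀ {u v} → Connected E u v → Connected F u v
  Connected-mono E⊆F = gmap id (Sum.map E⊆F E⊆F)

  Connected-preserves : ∀ {E : List (V × V)} (P : V → Set) → (∀ {u v} → Adj E u v → P u → P v) →
                        ∀ {u v} → Connected E u v → P u → P v
  Connected-preserves P step ε pu = pu
  Connected-preserves P step (a ◅ w) pu = Connected-preserves P step w (step a pu)

  Connected-isolated : ∀ {E : List (V × V)} {x y} → (∀ {z} → ¬ Adj E x z) → Connected E x y → x ≡ y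
  Connected-isolated isolated ε = refl
  Connected-isolated isolated (a ◅ _) = contradiction a isolated

  ConnectedVia : List (V × V) → V → V → V → V → Set
  ConnectedVia L a b s t =
    Connected L s t ⊎ (Connected L s a × Connected L b t) ⊎ (Connected L s b × Connected L a t)

  Connected-∷⁻ : ∀ {a b L s t} → Connected ((a , b) ∷ L) s t → ConnectedVia L a b s t
  Connected-∷⁻ ε = inj₁ ε
  Connected-∷⁻ {a} {b} {L} (adj ◅ w) = prepend adj (Connected-∷⁻ w)
    where
    extend : ∀ {s x t} → Adj L s x → ConnectedVia L a b x t → ConnectedVia L a b s t
    extend adj (inj₁ c) = inj₁ (adj ◅ c)
    extend adj (inj₂ (inj₁ (c , d))) = inj₂ (inj₁ (adj ◅ c , d))
    extend adj (inj₂ (inj₂ (c , d))) = inj₂ (inj₂ (adj ◅ c , d))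
    prepend : ∀ {s x t} → Adj ((a , b) ∷ L) s x → ConnectedVia L a b x t → ConnectedVia L a b s t
    prepend (inj₁ (there p)) = extend (inj₁ p)
    prepend (inj₂ (there p)) = extend (inj₂ p)
    prepend (inj₁ (here refl)) (inj₁ c) = inj₂ (inj₁ (ε , c))
    prepend (inj₁ (here refl)) (inj₂ (inj₁ (_ , d))) = inj₂ (inj₁ (ε , d))
    prepend (inj₁ (here refl)) (inj₂ (inj₂ (_ , d))) = inj₁ d
    prepend (inj₂ (here refl)) (inj₁ c) = inj₂ (inj₂ (ε , c))
    prepend (inj₂ (here refl)) (inj₂ (inj₁ (_ , d))) = inj₁ d
    prepend (inj₂ (here refl)) (inj₂ (inj₂ (_ , d))) = inj₂ (inj₂ (ε , d))

  Connected-∷⁺ : ∀ {a b L s t} → ConnectedVia L a b s t → Connected ((a , b) ∷ L) s t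
  Connected-∷⁺ (inj₁ c) = Connected-mono there c
  Connected-∷⁺ (inj₂ (inj₁ (c , d))) =
    Connected-mono there c ◅◅ edge⇒Connected (here refl) ◅◅ Connected-mono there d
  Connected-∷⁺ (inj₂ (inj₂ (c , d))) =
    Connected-mono there c ◅◅ Connected-sym (edge⇒Connected (here refl)) ◅◅ Connected-mono there d

  -- Basis exchange in the cycle matroid.
  Connected-∷-exchange : ∀ {a b L s t} → ¬ Connected L s t →
                         Connected ((a , b) ∷ L) s t → Connected ((s , t) ∷ L) a b
  Connected-∷-exchange s≁t c with Connected-∷⁻ c
  ... | inj₁ s~t = contradiction s~t s≁t
  ... | inj₂ (inj₁ (s~a , b~t)) = Connected-∷⁺ (inj₂ (inj₁ (Connected-sym s~a , Connected-sym b~t)))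
  ... | inj₂ (inj₂ (s~b , a~t)) = Connected-∷⁺ (inj₂ (inj₂ (a~t , s~b)))

  connected? : DecidableEquality V → ∀ E s t → Dec (Connected E s t)
  connected? _≟_ [] s t with s ≟ t
  ... | yes refl = yes ε
  ... | no s≢t = no λ { ε → s≢t refl ; (inj₁ () ◅ _) ; (inj₂ () ◅ _) }
  connected? _≟_ ((a , b) ∷ L) s t =
    map′ Connected-∷⁺ Connected-∷⁻ (c s t ⊎-dec c s a ×-dec c b t ⊎-dec c s b ×-dec c a t)
    where c = connected? _≟_ L

module _ {V W : Set} (g : V → W) where

  Adj-map⁺ : ∀ {E : List (V × V)} {u v} → Adj E u v → Adj (map (mapEdge g) E) (g u) (g v)
  Adj-map⁺ = Sum.map (∈-map⁺ (mapEdge g)) (∈-map⁺ (mapEdge g))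

  Adj-map⁻ : ∀ {E : List (V × V)} {x y} → Adj (map (mapEdge g) E) x y →
             ∃ λ u → ∃ λ v → x ≡ g u × y ≡ g v × Adj E u v
  Adj-map⁻ (inj₁ p) with ∈-map⁻ (mapEdge g) p
  ... | (u , v) , uv∈E , refl = u , v , refl , refl , inj₁ uv∈E
  Adj-map⁻ (inj₂ p) with ∈-map⁻ (mapEdge g) p
  ... | (u , v) , uv∈E , refl = v , u , refl , refl , inj₂ uv∈E

  Connected-map : ∀ {E : List (V × V)} {u v} → Connected E u v → Connected (map (mapEdge g) E) (g u) (g v)
  Connected-map = gmap g Adj-map⁺

  module _ (g-inj : Injective _≡_ _≡_ g) {E : List (V × V)} where

    Connected-map⁻-image : ∀ {u t} → Connected (map (mapEdge g) E) (g u) t →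
                           ∃ λ v → t ≡ g v × Connected E u v
    Connected-map⁻-image ε = _ , refl , ε
    Connected-map⁻-image (adj ◅ w) with Adj-map⁻ adj
    ... | _ , _ , gu≡gu′ , refl , adj′ with g-inj gu≡gu′
    ... | refl with Connected-map⁻-image w
    ...   | v , t≡gv , w′ = v , t≡gv , adj′ ◅ w′

    Connected-map⁻ : ∀ {u v} → Connected (map (mapEdge g) E) (g u) (g v) → Connected E u v
    Connected-map⁻ c with Connected-map⁻-image c
    ... | _ , gv≡gv′ , w with g-inj gv≡gv′
    ...   | refl = w

data Acyclic {V : Set} : List (V × V) → Set where
  [] : Acyclic []
  _∷_ : ∀ {u v L} → ¬ Connected L u v → Acyclic L → Acyclic ((u , v) ∷ L)

module _ {V : Set} where

  lookup∷removeAt⊆ : ∀ (L : List (V × V)) k {e} → e ∈ lookup L k ∷ removeAt L k → e ∈ L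
  lookup∷removeAt⊆ L k (here refl) = ∈-lookup k
  lookup∷removeAt⊆ (_ ∷ L) zero (there p) = there p
  lookup∷removeAt⊆ (_ ∷ L) (suc k) (there (here refl)) = here refl
  lookup∷removeAt⊆ (_ ∷ L) (suc k) (there (there p)) = there (lookup∷removeAt⊆ L k (there p))

  Acyclic⇒¬HasCycle : ∀ {E : List (V × V)} → Acyclic E → ¬ HasCycle E
  Acyclic⇒¬HasCycle (u≁v ∷ _) (zero , c) = u≁v c
  Acyclic⇒¬HasCycle {_ ∷ L} (u≁v ∷ acyc) (suc k , c) =
    u≁v (Connected-mono (lookup∷removeAt⊆ L k)
          (Connected-∷-exchange (λ c′ → Acyclic⇒¬HasCycle acyc (k , c′)) c))

  ¬HasCycle⇒Acyclic : ∀ (E : List (V × V)) → ¬ HasCycle E → Acyclic E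
  ¬HasCycle⇒Acyclic [] _ = []
  ¬HasCycle⇒Acyclic (_ ∷ L) noCycle =
    (λ c → noCycle (zero , c)) ∷
    ¬HasCycle⇒Acyclic L (λ (k , c) → noCycle (suc k , Connected-mono there c))

  Connected-resp-↭ : ∀ {E F : List (V × V)} → E ↭ F → ∀ {u v} → Connected E u v → Connected F u v
  Connected-resp-↭ E↭F = Connected-mono (∈-resp-↭ E↭F)

  Acyclic-swap : ∀ {x y : V × V} {L} → Acyclic (x ∷ y ∷ L) → Acyclic (y ∷ x ∷ L)
  Acyclic-swap (a≁b ∷ c≁d ∷ acyc) =
    (λ c~d → a≁b (Connected-∷-exchange c≁d c~d)) ∷ (a≁b ∘ Connected-mono there) ∷ acyc

  Acyclic-resp-↭ : ∀ {E F : List (V × V)} → E ↭ F → Acyclic E → Acyclic F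
  Acyclic-resp-↭ ↭.refl acyc = acyc
  Acyclic-resp-↭ (↭.prep _ E↭F) (u≁v ∷ acyc) =
    (u≁v ∘ Connected-resp-↭ (↭-sym E↭F)) ∷ Acyclic-resp-↭ E↭F acyc
  Acyclic-resp-↭ (↭.swap _ y E↭F) (x≁ ∷ y≁ ∷ acyc) =
    Acyclic-swap ((x≁ ∘ Connected-resp-↭ (↭.prep y (↭-sym E↭F))) ∷
                  (y≁ ∘ Connected-resp-↭ (↭-sym E↭F)) ∷ Acyclic-resp-↭ E↭F acyc)
  Acyclic-resp-↭ (↭.trans E↭F F↭G) = Acyclic-resp-↭ F↭G ∘ Acyclic-resp-↭ E↭F

module _ {V W : Set} (g : V → W) where

  Acyclic-map⁺ : Injective _≡_ _≡_ g → ∀ {E : List (V × V)} → Acyclic E → Acyclic (map (mapEdge g) E)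
  Acyclic-map⁺ g-inj [] = []
  Acyclic-map⁺ g-inj (u≁v ∷ acyc) = (u≁v ∘ Connected-map⁻ g g-inj) ∷ Acyclic-map⁺ g-inj acyc

  Acyclic-map⁻ : ∀ (E : List (V × V)) → Acyclic (map (mapEdge g) E) → Acyclic E
  Acyclic-map⁻ [] [] = []
  Acyclic-map⁻ (_ ∷ E) (gu≁gv ∷ acyc) = (gu≁gv ∘ Connected-map g) ∷ Acyclic-map⁻ E acyc

module _ {U V V′ : Set} {f : U → V} {f′ : U → V′} {E : List (V × V)} {E′ : List (V′ × V′)}
         (E′⇒E : ∀ u v → Connected E′ (f′ u) (f′ v) → Connected E (f u) (f v)) where

  Connected-exchange : ∀ D {u v} → Connected (map (mapEdge f′) D ++ E′) (f′ u) (f′ v) →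
                       Connected (map (mapEdge f) D ++ E) (f u) (f v)
  Connected-exchange [] = E′⇒E _ _
  Connected-exchange (_ ∷ D) c with Connected-∷⁻ c
  ... | inj₁ c′ = Connected-∷⁺ (inj₁ (Connected-exchange D c′))
  ... | inj₂ (inj₁ (c₁ , c₂)) =
    Connected-∷⁺ (inj₂ (inj₁ (Connected-exchange D c₁ , Connected-exchange D c₂)))
  ... | inj₂ (inj₂ (c₁ , c₂)) =
    Connected-∷⁺ (inj₂ (inj₂ (Connected-exchange D c₁ , Connected-exchange D c₂)))

  Acyclic-exchange : Acyclic E′ → ∀ D →
                     Acyclic (map (mapEdge f) D ++ E) → Acyclic (map (mapEdge f′) D ++ E′)
  Acyclic-exchange acyc′ [] _ = acyc′
  Acyclic-exchange acyc′ (_ ∷ D) (u≁v ∷ acyc) =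
    (u≁v ∘ Connected-exchange D) ∷ Acyclic-exchange acyc′ D acyc

module _ {A B : Set} (r : A → B) where

  leaf : A → (A ⊎ B) × (A ⊎ B)
  leaf x = inj₁ x , inj₂ (r x)

  Acyclic-leaves : ∀ {xs : List A} → Unique xs → Acyclic (map leaf xs)
  Acyclic-leaves [] = []
  Acyclic-leaves (x∉xs ∷ xs-unique) =
    (inj₁≢inj₂ ∘ Connected-isolated (isolated x∉xs)) ∷ Acyclic-leaves xs-unique
    where
    inj₁≢inj₂ : ∀ {x y} → inj₁ x ≢ inj₂ y
    inj₁≢inj₂ ()
    isolated : ∀ {x xs} → All (x ≢_) xs → ∀ {z} → ¬ Adj (map leaf xs) (inj₁ x) z
    isolated x∉xs (inj₁ p) with ∈-map⁻ leaf p
    ... | y , y∈xs , refl = All-lookup x∉xs y∈xs refl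
    isolated x∉xs (inj₂ p) with ∈-map⁻ leaf p
    ... | _ , _ , ()

module _ {n : ℕ} (π : Partition n) where

  private
    blocks : ℕ
    blocks = suc (max 0 (map π (allFin n)))

    block : Fin n → Fin blocks
    block i = fromℕ< (s≤s (All-lookup (xs≤max 0 (map π (allFin n))) (∈-map⁺ π (∈-allFin i))))

    label : Vtx n blocks → ℕ
    label (inj₁ i) = π i
    label (inj₂ c) = toℕ c

  star : Graph n
  star = record { inner = blocks ; edges = map (leaf block) (allFin n) }

  private
    label-leaf : ∀ i → label (inj₁ i) ≡ label (inj₂ (block i))
    label-leaf i = sym (toℕ-fromℕ< _)

    label-adj : ∀ {u v} → Adj (edges star) u v → label u ≡ label v
    label-adj (inj₁ p) with ∈-map⁻ (leaf block) p
    ... | i , _ , refl = label-leaf i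
    label-adj (inj₂ p) with ∈-map⁻ (leaf block) p
    ... | i , _ , refl = sym (label-leaf i)

    label-connected : ∀ {u v} → Connected (edges star) u v → label u ≡ label v
    label-connected {u} c =
      Connected-preserves (λ v → label u ≡ label v) (λ adj e → trans e (label-adj adj)) c refl

  star-rep : IsRepForest π star
  star-rep = Acyclic⇒¬HasCycle (Acyclic-leaves block (allFin⁺ n)) , λ j → inj₂ (block j) , λ i →
    mk⇔ (λ c → trans (label-connected c) (sym (label-leaf j)))
        (λ πi≡πj → subst (λ c → Connected (edges star) (inj₁ i) (inj₂ c)) (fromℕ<-cong _ _ πi≡πj _ _)
                         (edge⇒Connected (∈-map⁺ (leaf block) (∈-allFin i))))

mapEdge-cong : ∀ {A B : Set} {f g : A → B} → f ≗ g → mapEdge f ≗ mapEdge g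
mapEdge-cong f≗g (u , v) = cong₂ _,_ (f≗g u) (f≗g v)

module _ {n : ℕ} where

  embL-injective : ∀ {a} b → Injective _≡_ _≡_ (embL {n} {a} b)
  embL-injective b {inj₁ i} {inj₁ .i} refl = refl
  embL-injective b {inj₂ k} {inj₂ l} eq = cong inj₂ (↑ˡ-injective b k l (inj₂-injective eq))

  embR-injective : ∀ a {b} → Injective _≡_ _≡_ (embR {n} a {b})
  embR-injective a {_} {inj₁ i} {inj₁ .i} refl = refl
  embR-injective a {_} {inj₂ k} {inj₂ l} eq = cong inj₂ (↑ʳ-injective a k l (inj₂-injective eq))

  embL≡embR⇒boundary : ∀ {a b} {x : Vtx n a} {y : Vtx n b} → embL b x ≡ embR a y →
                       ∃ λ i → x ≡ inj₁ i × y ≡ inj₁ i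
  embL≡embR⇒boundary {x = inj₁ i} {inj₁ .i} refl = i , refl , refl
  embL≡embR⇒boundary {a} {b} {inj₂ k} {inj₂ l} eq
    with trans (sym (splitAt-↑ˡ a k b)) (trans (cong (splitAt a) (inj₂-injective eq)) (splitAt-↑ʳ a b l))
  ... | ()

  map-glue : ∀ {V : Set} (G H : Graph n) (ψ : Vtx n (inner G + inner H) → V) →
             map (mapEdge ψ) (edges (glue G H)) ≡
             map (mapEdge (ψ ∘ embL (inner H))) (edges G) ++ map (mapEdge (ψ ∘ embR (inner G))) (edges H)
  map-glue G H ψ = trans (map-++ (mapEdge ψ) (map (mapEdge (embL (inner H))) (edges G)) _)
                         (sym (cong₂ _++_ (map-∘ (edges G)) (map-∘ (edges H))))

  module _ (G H : Graph n) where

    private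
      a = inner G
      b = inner H

      swapInner : Vtx n (b + a) → Vtx n (a + b)
      swapInner = Sum.map₂ (λ k → [ a ↑ʳ_ , _↑ˡ b ]′ (splitAt b k))

      swapInner-embL : swapInner ∘ embL a ≗ embR a
      swapInner-embL (inj₁ i) = refl
      swapInner-embL (inj₂ k) = cong (inj₂ ∘ [ a ↑ʳ_ , _↑ˡ b ]′) (splitAt-↑ˡ b k a)

      swapInner-embR : swapInner ∘ embR b ≗ embL b
      swapInner-embR (inj₁ i) = refl
      swapInner-embR (inj₂ k) = cong (inj₂ ∘ [ a ↑ʳ_ , _↑ˡ b ]′) (splitAt-↑ʳ b a k)

    Acyclic-glue-comm : Acyclic (edges (glue G H)) → Acyclic (edges (glue H G))
    Acyclic-glue-comm acyc =
      Acyclic-map⁻ swapInner (edges (glue H G)) (subst Acyclic (sym swapped) acyc′)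
      where
      acyc′ : Acyclic (map (mapEdge (embR a)) (edges H) ++ map (mapEdge (embL b)) (edges G))
      acyc′ = Acyclic-resp-↭ (++-comm (map (mapEdge (embL b)) (edges G)) _) acyc
      swapped : map (mapEdge swapInner) (edges (glue H G)) ≡
                map (mapEdge (embR a)) (edges H) ++ map (mapEdge (embL b)) (edges G)
      swapped = trans (map-glue H G swapInner)
                      (cong₂ _++_ (map-cong (mapEdge-cong swapInner-embL) (edges H))
                                  (map-cong (mapEdge-cong swapInner-embR) (edges G)))

  module _ (A B C : Graph n) where

    private
      a = inner A
      b = inner B
      c = inner C

      left : Fin a → Fin ((a + b) + c)
      left x = (x ↑ˡ b) ↑ˡ c

      middle : Fin b → Fin ((a + b) + c)
      middle y = (a ↑ʳ y) ↑ˡ c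

      right : Fin c → Fin ((a + b) + c)
      right z = (a + b) ↑ʳ z

      middle-or-right : Fin (b + c) → Fin ((a + b) + c)
      middle-or-right k = [ middle , right ]′ (splitAt b k)

      reassoc : Vtx n (a + (b + c)) → Vtx n ((a + b) + c)
      reassoc = Sum.map₂ (λ k → [ left , middle-or-right ]′ (splitAt a k))

      reassoc-A : reassoc ∘ embL (b + c) ≗ embL c ∘ embL b
      reassoc-A (inj₁ i) = refl
      reassoc-A (inj₂ x) = cong (inj₂ ∘ [ left , middle-or-right ]′) (splitAt-↑ˡ a x (b + c))

      reassoc-B : reassoc ∘ embR a ∘ embL c ≗ embL c ∘ embR a
      reassoc-B (inj₁ i) = refl
      reassoc-B (inj₂ y) =
        trans (cong (inj₂ ∘ [ left , middle-or-right ]′) (splitAt-↑ʳ a (b + c) (y ↑ˡ c)))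
              (cong (inj₂ ∘ [ middle , right ]′) (splitAt-↑ˡ b y c))

      reassoc-C : reassoc ∘ embR a ∘ embR b ≗ embR (a + b)
      reassoc-C (inj₁ i) = refl
      reassoc-C (inj₂ z) =
        trans (cong (inj₂ ∘ [ left , middle-or-right ]′) (splitAt-↑ʳ a (b + c) (b ↑ʳ z)))
              (cong (inj₂ ∘ [ middle , right ]′) (splitAt-↑ʳ b c z))

      reassociated : map (mapEdge reassoc) (edges (glue A (glue B C))) ≡ edges (glue (glue A B) C)
      reassociated = begin
        map (mapEdge reassoc) (edges (glue A (glue B C)))
          ≡⟨ map-glue A (glue B C) reassoc ⟩
        map (mapEdge (reassoc ∘ embL (b + c))) (edges A) ++
          map (mapEdge (reassoc ∘ embR a)) (edges (glue B C))
          ≡⟨ cong (map (mapEdge (reassoc ∘ embL (b + c))) (edges A) ++_) (map-glue B C (reassoc ∘ embR a)) ⟩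
        map (mapEdge (reassoc ∘ embL (b + c))) (edges A) ++
          (map (mapEdge (reassoc ∘ embR a ∘ embL c)) (edges B) ++
           map (mapEdge (reassoc ∘ embR a ∘ embR b)) (edges C))
          ≡⟨ cong₂ _++_ (map-cong (mapEdge-cong reassoc-A) (edges A))
                        (cong₂ _++_ (map-cong (mapEdge-cong reassoc-B) (edges B))
                                    (map-cong (mapEdge-cong reassoc-C) (edges C))) ⟩
        map (mapEdge (embL c ∘ embL b)) (edges A) ++
          (map (mapEdge (embL c ∘ embR a)) (edges B) ++ map (mapEdge (embR (a + b))) (edges C))
          ≡⟨ ++-assoc (map (mapEdge (embL c ∘ embL b)) (edges A)) _ _ ⟨
        (map (mapEdge (embL c ∘ embL b)) (edges A) ++ map (mapEdge (embL c ∘ embR a)) (edges B)) ++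
          map (mapEdge (embR (a + b))) (edges C)
          ≡⟨ cong (_++ map (mapEdge (embR (a + b))) (edges C)) (map-glue A B (embL c)) ⟨
        edges (glue (glue A B) C) ∎
        where open ≡-Reasoning

    Acyclic-glue-assoc : Acyclic (edges (glue (glue A B) C)) → Acyclic (edges (glue A (glue B C)))
    Acyclic-glue-assoc acyc =
      Acyclic-map⁻ reassoc (edges (glue A (glue B C))) (subst Acyclic (sym reassociated) acyc)

Connects : ∀ {n} → Graph n → Fin n → Fin n → Set
Connects G i j = Connected (edges G) (inj₁ i) (inj₁ j)

Acyclic-glue-exchange : ∀ {n} (D H H′ : Graph n) → Acyclic (edges H′) →
                (∀ i j → Connects H′ i j → Connects H i j) →
                Acyclic (edges (glue D H)) → Acyclic (edges (glue D H′))
Acyclic-glue-exchange D H H′ acyc′ H′⊆H =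
  Acyclic-exchange H′⇒H (Acyclic-map⁺ embD (embR-injective d) acyc′) (edges D)
  where
  d = inner D
  embD = embR d
  untouched : ∀ k {z} → ¬ Adj (map (mapEdge embD) (edges H′)) (embL (inner H′) (inj₂ k)) z
  untouched k adj with Adj-map⁻ embD adj
  ... | _ , _ , e , _ with embL≡embR⇒boundary e
  ...   | _ , () , _
  H′⇒H : ∀ u v → Connected (map (mapEdge embD) (edges H′)) (embL (inner H′) u) (embL (inner H′) v) →
                 Connected (map (mapEdge embD) (edges H)) (embL (inner H) u) (embL (inner H) v)
  H′⇒H (inj₁ i) (inj₁ j) c = Connected-map embD (H′⊆H i j (Connected-map⁻ embD (embR-injective d) c))
  H′⇒H (inj₂ k) v c with embL-injective (inner H′) (Connected-isolated (untouched k) c)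
  ... | refl = ε
  H′⇒H (inj₁ i) (inj₂ k) c with embL-injective (inner H′) (Connected-isolated (untouched k) (Connected-sym c))
  ... | ()

module _ {n : ℕ} where

  IsJoin-comm : ∀ {α β σ : Partition n} → IsJoin α β σ → IsJoin β α σ
  IsJoin-comm (σ⊒α , σ⊒β , least) = σ⊒β , σ⊒α , λ τ τ⊒β τ⊒α → least τ τ⊒α τ⊒β

  private
    indicator : ∀ {A : Set} → Dec A → ℕ
    indicator (yes _) = 0
    indicator (no _) = 1

    indicator-cong : ∀ {A B : Set} → (A → B) → (B → A) →
                     (a? : Dec A) (b? : Dec B) → indicator a? ≡ indicator b?
    indicator-cong A⇒B B⇒A (yes a) (yes b) = refl
    indicator-cong A⇒B B⇒A (yes a) (no ¬b) = contradiction (A⇒B a) ¬b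
    indicator-cong A⇒B B⇒A (no ¬a) (yes b) = contradiction (B⇒A b) ¬a
    indicator-cong A⇒B B⇒A (no ¬a) (no ¬b) = refl

    indicator-yes : ∀ {A : Set} → A → (a? : Dec A) → indicator a? ≡ 0
    indicator-yes a (yes _) = refl
    indicator-yes a (no ¬a) = contradiction a ¬a

    indicator≡0 : ∀ {A : Set} (a? : Dec A) → indicator a? ≡ 0 → A
    indicator≡0 (yes a) _ = a

  join-⊆ : ∀ {α β σ : Partition n} → IsJoin α β σ →
           ∀ {R : Fin n → Fin n → Set} → IsDecEquivalence R →
           (∀ i j → α i ≡ α j → R i j) → (∀ i j → β i ≡ β j → R i j) →
           ∀ i j → σ i ≡ σ j → R i j
  join-⊆ (_ , _ , least) {R} R-equiv α⊆R β⊆R i j σi≡σj =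
    indicator≡0 (i R.≟ j)
      (trans (sym (least τ (τ⊒ α⊆R) (τ⊒ β⊆R) i j σi≡σj)) (indicator-yes R.refl (i R.≟ i)))
    where
    module R = IsDecEquivalence R-equiv
    -- The two-block partition separating the R-class of i from everything else.
    τ : Partition n
    τ k = indicator (i R.≟ k)
    τ⊒ : ∀ {γ : Partition n} → (∀ k l → γ k ≡ γ l → R k l) → Coarser τ γ
    τ⊒ γ⊆R k l γk≡γl =
      indicator-cong (λ ik → R.trans ik (γ⊆R k l γk≡γl)) (λ il → R.trans il (R.sym (γ⊆R k l γk≡γl)))
                     (i R.≟ k) (i R.≟ l)

Realises : ∀ {n} → Graph n → Partition n → Set
Realises G π = ∀ i j → Connects G i j ⇔ (π i ≡ π j)

IsRepForest⇒Realises : ∀ {n} {π : Partition n} {G : Graph n} → IsRepForest π G → Realises G π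
IsRepForest⇒Realises (_ , component) i j with component j
... | _ , i∈C = mk⇔ (λ i~j → to (i∈C i) (i~j ◅◅ from (i∈C j) refl))
                    (λ πi≡πj → from (i∈C i) πi≡πj ◅◅ Connected-sym (from (i∈C j) refl))

module _ {n : ℕ} {G H : Graph n} {α β σ : Partition n}
         (G-α : Realises G α) (H-β : Realises H β) (join : IsJoin α β σ) where

  private
    a = inner G
    b = inner H
    σ⊒α = proj₁ join
    σ⊒β = proj₁ (proj₂ join)

    Reached : ℕ → Vtx n (a + b) → Set
    Reached s v = ∃ λ k → σ k ≡ s ×
      ((∃ λ u → v ≡ embL b u × Connected (edges G) (inj₁ k) u) ⊎
       (∃ λ w → v ≡ embR a w × Connected (edges H) (inj₁ k) w))

    Reached-stepG : ∀ {s p q} → Adj (edges G) p q → Reached s (embL b p) → Reached s (embL b q)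
    Reached-stepG pq (k , σk≡s , inj₁ (_ , p≡u , k~u)) with embL-injective b p≡u
    ... | refl = k , σk≡s , inj₁ (_ , refl , k~u ◅◅ return pq)
    Reached-stepG pq (k , σk≡s , inj₂ (_ , p≡w , k~w)) with embL≡embR⇒boundary p≡w
    ... | i , refl , refl =
      i , trans (sym (σ⊒β k i (to (H-β k i) k~w))) σk≡s , inj₁ (_ , refl , return pq)

    Reached-stepH : ∀ {s p q} → Adj (edges H) p q → Reached s (embR a p) → Reached s (embR a q)
    Reached-stepH pq (k , σk≡s , inj₂ (_ , p≡w , k~w)) with embR-injective a p≡w
    ... | refl = k , σk≡s , inj₂ (_ , refl , k~w ◅◅ return pq)
    Reached-stepH pq (k , σk≡s , inj₁ (_ , p≡u , k~u)) with embL≡embR⇒boundary (sym p≡u)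
    ... | i , refl , refl =
      i , trans (sym (σ⊒α k i (to (G-α k i) k~u))) σk≡s , inj₂ (_ , refl , return pq)

    Reached-step : ∀ {s v v′} → Adj (edges (glue G H)) v v′ → Reached s v → Reached s v′
    Reached-step adj with Adj-++⁻ adj
    ... | inj₁ adjG with Adj-map⁻ (embL b) adjG
    ...   | _ , _ , refl , refl , pq = Reached-stepG pq
    Reached-step adj | inj₂ adjH with Adj-map⁻ (embR a) adjH
    ...   | _ , _ , refl , refl , pq = Reached-stepH pq

    glue-connects⇒join : ∀ i j → Connects (glue G H) i j → σ i ≡ σ j
    glue-connects⇒join i j i~j
      with Connected-preserves (Reached (σ i)) Reached-step i~j (i , refl , inj₁ (_ , refl , ε))
    ... | k , σk≡σi , inj₁ (_ , j≡u , k~u) with embL-injective b j≡u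
    ...   | refl = trans (sym σk≡σi) (σ⊒α k j (to (G-α k j) k~u))
    glue-connects⇒join i j i~j | k , σk≡σi , inj₂ (_ , j≡w , k~w) with embR-injective a j≡w
    ...   | refl = trans (sym σk≡σi) (σ⊒β k j (to (H-β k j) k~w))

    Connects-isDecEquivalence : IsDecEquivalence (Connects (glue G H))
    Connects-isDecEquivalence = record
      { isEquivalence = record { refl = ε ; sym = Connected-sym ; trans = _◅◅_ }
      ; _≟_ = λ i j → connected? (≡-dec Fin._≟_ Fin._≟_) _ (inj₁ i) (inj₁ j)
      }

    join⇒glue-connects : ∀ i j → σ i ≡ σ j → Connects (glue G H) i j
    join⇒glue-connects = join-⊆ join Connects-isDecEquivalence
      (λ i j αi≡αj → Connected-mono ∈-++⁺ˡ (Connected-map (embL b) (from (G-α i j) αi≡αj)))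
      (λ i j βi≡βj → Connected-mono (∈-++⁺ʳ _) (Connected-map (embR a) (from (H-β i j) βi≡βj)))

  glue-realises-join : Realises (glue G H) σ
  glue-realises-join i j = mk⇔ (glue-connects⇒join i j) (join⇒glue-connects i j)

module _ {n : ℕ} where

  glue-rep : ∀ {α β σ : Partition n} {G H : Graph n} → α ∼ β → IsJoin α β σ →
             IsRepForest α G → IsRepForest β H → IsRepForest σ (glue G H)
  glue-rep {G = G} {H} α∼β join G-α H-β =
    (λ cycle → α∼β (G , H , G-α , H-β , cycle)) ,
    λ j → inj₁ j , λ i → glue-realises-join (IsRepForest⇒Realises G-α) (IsRepForest⇒Realises H-β) join i j

  ∼-sym : ∀ {π ρ : Partition n} → π ∼ ρ → ρ ∼ π
  ∼-sym π∼ρ (Gρ , Gπ , ρ-rep , π-rep , cycle) =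
    Acyclic⇒¬HasCycle (Acyclic-glue-comm Gπ Gρ πρ-acyclic) cycle
    where
    πρ-acyclic : Acyclic (edges (glue Gπ Gρ))
    πρ-acyclic = ¬HasCycle⇒Acyclic _ λ c → π∼ρ (Gπ , Gρ , π-rep , ρ-rep , c)

  ∼-join-transfer : ∀ {π χ ρ πχ ρχ : Partition n} → IsJoin π χ πχ → IsJoin ρ χ ρχ →
                    π ∼ χ → πχ ∼ ρ → π ∼ ρχ
  ∼-join-transfer {χ = χ} {ρ} {ρχ = ρχ} πχ-join ρχ-join π∼χ πχ∼ρ (Gπ , Gρχ , π-rep , ρχ-rep , cycle) =
    Acyclic⇒¬HasCycle π[ρχ]-acyclic cycle
    where
    Gχ = star χ
    Gρ = star ρ
    [πχ]ρ-acyclic : Acyclic (edges (glue (glue Gπ Gχ) Gρ))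
    [πχ]ρ-acyclic = ¬HasCycle⇒Acyclic _ λ c →
      πχ∼ρ (glue Gπ Gχ , Gρ , glue-rep π∼χ πχ-join π-rep (star-rep χ) , star-rep ρ , c)
    glue-χρ-realises : Realises (glue Gχ Gρ) ρχ
    glue-χρ-realises = glue-realises-join (IsRepForest⇒Realises (star-rep χ)) (IsRepForest⇒Realises (star-rep ρ))
                                 (IsJoin-comm ρχ-join)
    ρχ⊆χρ : ∀ i j → Connects Gρχ i j → Connects (glue Gχ Gρ) i j
    ρχ⊆χρ i j = from (glue-χρ-realises i j) ∘ to (IsRepForest⇒Realises ρχ-rep i j)
    π[ρχ]-acyclic : Acyclic (edges (glue Gπ Gρχ))
    π[ρχ]-acyclic = Acyclic-glue-exchange Gπ (glue Gχ Gρ) Gρχ (¬HasCycle⇒Acyclic _ (proj₁ ρχ-rep)) ρχ⊆χρ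
                      (Acyclic-glue-assoc Gπ Gχ Gρ [πχ]ρ-acyclic)

lemma32 : ∀ (n : ℕ) (π χ ρ πχ ρχ : Partition n) →
    IsJoin π χ πχ → IsJoin ρ χ ρχ →
    π ∼ χ → ρ ∼ χ →
    (πχ ∼ ρ) ⇔ (π ∼ ρχ)
lemma32 n π χ ρ πχ ρχ πχ-join ρχ-join π∼χ ρ∼χ =
  mk⇔ (∼-join-transfer πχ-join ρχ-join π∼χ)
      (∼-sym ∘ ∼-join-transfer ρχ-join πχ-join ρ∼χ ∘ ∼-sym)
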